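{- Let $D$ be a multipartite tournament with no sinks, and suppose some partite set $X$ of $D$ contains an anti-$\{1,2\}$-competing set of size three. Then every anti-$\{1,2\}$-competing set of $D$ of size at least three is contained in $X$.
   Context: All graphs and digraphs are finite and simple. For a digraph $D$, a sink is a vertex of outdegree $0$; $d_D(x,y)$ is the length of a shortest directed path from $x$ to $y$. The $(1,2)$-step competition graph $C_{1,2}(D)$ is the graph on $V(D)$ in which distinct $u,v$ are adjacent iff there is a vertex $w\notin\{u,v\}$ with either $d_{D-v}(u,w)\le 1$ and $d_{D-u}(v,w)\le 2$, or $d_{D-u}(v,w)\le 1$ and $d_{D-v}(u,w)\le 2$. A multipartite tournament is an orientation of a complete $k$-partite graph for some $k\ge3$ (with nonempty partite sets). A set of vertices is anti-$\{1,2\}$-competing if it is a stable set in $C_{1,2}(D)$. -}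

module Defs where

open import Data.Nat using (ℕ; zero; suc; _≥_)
open import Data.Fin using (Fin)
open import Data.Fin.Subset using (Subset; _∈_; ∣_∣)
open import Data.Bool using (Bool; true)
open import Data.Product using (Σ; ∃; _×_; _,_)
open import Data.Sum using (_⊎_)
open import Relation.Binary.PropositionalEquality using (_≡_; _≢_)
open import Relation.Nullary using (¬_)

Digraph : ℕ → Set
Digraph n = Fin n → Fin n → Bool

Arc : ∀ {n} → Digraph n → Fin n → Fin n → Set
Arc D u v = D u v ≡ true

-- A multipartite tournament: an orientation of a complete k-partite graph,
-- k ≥ 3, with partite sets given by a map part : Fin n → Fin k whose fibres
-- (the partite sets) are all nonempty.
record IsMultipartiteTournament {n : ℕ} (D : Digraph n) (k : ℕ) (part : Fin n → Fin k) : Set where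
  field
    k≥3       : k ≥ 3
    nonempty  : ∀ (i : Fin k) → ∃ λ v → part v ≡ i
    noArcSame : ∀ u v → part u ≡ part v → ¬ Arc D u v
    oriented  : ∀ u v → part u ≢ part v → (Arc D u v × ¬ Arc D v u) ⊎ (Arc D v u × ¬ Arc D u v)

NoSinks : ∀ {n} → Digraph n → Set
NoSinks {n} D = ∀ (u : Fin n) → ∃ λ v → Arc D u v

-- ReachAvoid D x k u w : there is a directed walk of length ≤ k from u to w
-- in D - x (all its vertices differ from x), i.e. d_{D-x}(u,w) ≤ k.
data ReachAvoid {n : ℕ} (D : Digraph n) (x : Fin n) : ℕ → Fin n → Fin n → Set where
  here : ∀ {k u} → u ≢ x → ReachAvoid D x k u u
  step : ∀ {k u z w} → u ≢ x → Arc D u z → ReachAvoid D x k z w → ReachAvoid D x (suc k) u w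

Adj12 : ∀ {n} → Digraph n → Fin n → Fin n → Set
Adj12 {n} D u v =
  u ≢ v × ∃ λ (w : Fin n) → w ≢ u × w ≢ v ×
    ((ReachAvoid D v 1 u w × ReachAvoid D u 2 v w) ⊎
     (ReachAvoid D u 1 v w × ReachAvoid D v 2 u w))

AntiCompeting : ∀ {n} → Digraph n → Subset n → Set
AntiCompeting {n} D S = ∀ (u v : Fin n) → u ∈ S → v ∈ S → ¬ Adj12 D u v

{-# OPTIONS --safe #-}
-- Two vertices with a common out-neighbour are adjacent in C_{1,2}(D). So if s, t ∈ X are
-- non-adjacent, every vertex outside X beats s or t; given three pairwise non-adjacent
-- vertices of X, every outside vertex beats two of them, hence any two outside vertices
-- have a common out-neighbour in X. Then any two outside vertices are adjacent, and a
-- vertex v outside X is adjacent to every x ∈ X having an out-neighbour p ≠ v, through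
-- x → p → t ← v. In a stable set {v, x, y, …} with v outside X, the vertices x and y must
-- therefore lie in X and, having no sinks, both beat v: a common out-neighbour again.
module Submission where

open import Defs
open import Data.Nat using (ℕ; suc; _≥_; _≤_; _<_; _+_; s≤s; z≤n)
open import Data.Nat.Properties
  using (≤-trans; ≤-reflexive; <⇒≱; +-suc; m≤n⇒m≤1+n; n≤1+n; module ≤-Reasoning)
open import Data.Fin using (Fin; _≟_)
open import Data.Fin.Subset using (Subset; _∈_; _∉_; _⊆_; _∪_; ⁅_⁆; ⊥; ∣_∣; inside; outside)
open import Data.Fin.Subset.Properties
  using (_∈?_; p⊆q⇒∣p∣≤∣q∣; ∣⁅x⁆∣≡1; ∣⊥∣≡0; x∈⁅x⁆; x∉⁅y⁆⇒x≢y; x∈p∪q⁺)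
open import Data.Fin.Properties using (any?)
open import Data.Vec using (_∷_; [])
open import Data.Product using (∃; ∃₂; _×_; _,_; proj₁)
open import Data.Sum using (_⊎_; inj₁; inj₂)
import Data.Sum as Sum
open import Function using (_∘_)
open import Relation.Nullary using (¬_; yes; no; contradiction)
open import Relation.Nullary.Decidable using (decidable-stable; _×-dec_; ¬?)
open import Relation.Binary.PropositionalEquality using (_≡_; _≢_; refl; sym; trans; cong; cong₂; subst)

∃-∈-∉ : ∀ {n} {p q : Subset n} → ∣ q ∣ < ∣ p ∣ → ∃ λ x → x ∈ p × x ∉ q
∃-∈-∉ {p = p} {q} ∣q∣<∣p∣ with any? (λ x → x ∈? p ×-dec ¬? (x ∈? q))
... | yes witness = witness
... | no none = contradiction (p⊆q⇒∣p∣≤∣q∣ p⊆q) (<⇒≱ ∣q∣<∣p∣)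
  where
  p⊆q : p ⊆ q
  p⊆q {x} x∈p = decidable-stable (x ∈? q) (λ x∉q → none (x , x∈p , x∉q))

∣p∪q∣≤∣p∣+∣q∣ : ∀ {n} (p q : Subset n) → ∣ p ∪ q ∣ ≤ ∣ p ∣ + ∣ q ∣
∣p∪q∣≤∣p∣+∣q∣ []            []            = z≤n
∣p∪q∣≤∣p∣+∣q∣ (outside ∷ p) (outside ∷ q) = ∣p∪q∣≤∣p∣+∣q∣ p q
∣p∪q∣≤∣p∣+∣q∣ (outside ∷ p) (inside  ∷ q) =
  subst (suc ∣ p ∪ q ∣ ≤_) (sym (+-suc ∣ p ∣ ∣ q ∣)) (s≤s (∣p∪q∣≤∣p∣+∣q∣ p q))
∣p∪q∣≤∣p∣+∣q∣ (inside  ∷ p) (outside ∷ q) = s≤s (∣p∪q∣≤∣p∣+∣q∣ p q)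
∣p∪q∣≤∣p∣+∣q∣ (inside  ∷ p) (inside  ∷ q) =
  s≤s (subst (∣ p ∪ q ∣ ≤_) (sym (+-suc ∣ p ∣ ∣ q ∣)) (m≤n⇒m≤1+n (∣p∪q∣≤∣p∣+∣q∣ p q)))

∣⁅x⁆∪⁅y⁆∣≤2 : ∀ {n} (x y : Fin n) → ∣ ⁅ x ⁆ ∪ ⁅ y ⁆ ∣ ≤ 2
∣⁅x⁆∪⁅y⁆∣≤2 x y = begin
  ∣ ⁅ x ⁆ ∪ ⁅ y ⁆ ∣     ≤⟨ ∣p∪q∣≤∣p∣+∣q∣ ⁅ x ⁆ ⁅ y ⁆ ⟩
  ∣ ⁅ x ⁆ ∣ + ∣ ⁅ y ⁆ ∣ ≡⟨ cong₂ _+_ (∣⁅x⁆∣≡1 x) (∣⁅x⁆∣≡1 y) ⟩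
  2                     ∎
  where open ≤-Reasoning

two-others : ∀ {n} {p : Subset n} → 3 ≤ ∣ p ∣ → (v : Fin n) →
  ∃₂ λ x y → x ∈ p × y ∈ p × x ≢ v × y ≢ v × x ≢ y
two-others ∣p∣≥3 v
  with x , x∈p , x∉⁅v⁆ ← ∃-∈-∉ (≤-trans (s≤s (≤-reflexive (∣⁅x⁆∣≡1 v))) (≤-trans (n≤1+n 2) ∣p∣≥3))
  with y , y∈p , y∉⁅v⁆∪⁅x⁆ ← ∃-∈-∉ (≤-trans (s≤s (∣⁅x⁆∪⁅y⁆∣≤2 v x)) ∣p∣≥3)
  = x , y , x∈p , y∈p , x∉⁅y⁆⇒x≢y x∉⁅v⁆ , x∉⁅y⁆⇒x≢y (y∉⁅v⁆∪⁅x⁆ ∘ x∈p∪q⁺ ∘ inj₁) , x≢y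
  where
  x≢y : x ≢ y
  x≢y refl = y∉⁅v⁆∪⁅x⁆ (x∈p∪q⁺ (inj₂ (x∈⁅x⁆ x)))

three-distinct : ∀ {n} {p : Subset n} → 3 ≤ ∣ p ∣ →
  ∃₂ λ a b → ∃ λ c → a ∈ p × b ∈ p × c ∈ p × a ≢ b × a ≢ c × b ≢ c
three-distinct {n} {p} ∣p∣≥3
  with a , a∈p , _ ← ∃-∈-∉ {q = ⊥} (subst (_< ∣ p ∣) (sym (∣⊥∣≡0 n)) (≤-trans (s≤s z≤n) ∣p∣≥3))
  with b , c , b∈p , c∈p , b≢a , c≢a , b≢c ← two-others ∣p∣≥3 a
  = a , b , c , a∈p , b∈p , c∈p , b≢a ∘ sym , c≢a ∘ sym , b≢c

module _ {A : Set} (R : A → A → Set) (a b c : A) where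

  HitsEveryPair : A → Set
  HitsEveryPair p = (R p a ⊎ R p b) × (R p a ⊎ R p c) × (R p b ⊎ R p c)

  private
    crossed : ∀ {P : A → Set} {p q} → P a → P b → P c → R p a → R q b →
      R p b ⊎ R p c → R q a ⊎ R q c → ∃ λ t → P t × R p t × R q t
    crossed _  Pb _  _  qb (inj₁ pb) _         = b , Pb , pb , qb
    crossed Pa _  _  pa _  (inj₂ _)  (inj₁ qa) = a , Pa , pa , qa
    crossed _  _  Pc _  _  (inj₂ pc) (inj₂ qc) = c , Pc , pc , qc

  -- p and q are each related to two of a, b, c, and two 2-subsets of a 3-set meet.
  hitsEveryPair⇒commonTarget : ∀ {P : A → Set} {p q} → P a → P b → P c →
    HitsEveryPair p → HitsEveryPair q → ∃ λ t → P t × R p t × R q t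
  hitsEveryPair⇒commonTarget Pa _  _  (inj₁ pa , _) (inj₁ qa , _) = a , Pa , pa , qa
  hitsEveryPair⇒commonTarget _  Pb _  (inj₂ pb , _) (inj₂ qb , _) = b , Pb , pb , qb
  hitsEveryPair⇒commonTarget Pa Pb Pc (inj₁ pa , _ , p-bc) (inj₂ qb , q-ac , _) =
    crossed Pa Pb Pc pa qb p-bc q-ac
  hitsEveryPair⇒commonTarget Pa Pb Pc (inj₂ pb , p-ac , _) (inj₁ qa , _ , q-bc)
    with t , Pt , qt , pt ← crossed Pa Pb Pc qa pb q-bc p-ac = t , Pt , pt , qt

module _ {n : ℕ} {D : Digraph n} where

  commonOut⇒Adj12 : ∀ {s t y} → s ≢ t → y ≢ s → y ≢ t → Arc D s y → Arc D t y → Adj12 D s t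
  commonOut⇒Adj12 s≢t y≢s y≢t s→y t→y =
    s≢t , _ , y≢s , y≢t , inj₁ (step s≢t s→y (here y≢t) , step (s≢t ∘ sym) t→y (here y≢s))

  path₂-arc⇒Adj12 : ∀ {x p y v} → x ≢ v → p ≢ v → y ≢ x → y ≢ v →
    Arc D x p → Arc D p y → Arc D v y → Adj12 D x v
  path₂-arc⇒Adj12 x≢v p≢v y≢x y≢v x→p p→y v→y =
    x≢v , _ , y≢x , y≢v ,
    inj₂ (step (x≢v ∘ sym) v→y (here y≢x) , step x≢v x→p (step p≢v p→y (here y≢v)))

module MultipartiteTournamentProperties {n k : ℕ} {D : Digraph n} {part : Fin n → Fin k}
  (mt : IsMultipartiteTournament D k part) where

  open IsMultipartiteTournament mt

  arc⇒part≢ : ∀ {u v} → Arc D u v → part u ≢ part v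
  arc⇒part≢ {u} {v} u→v same = noArcSame u v same u→v

  arc⇒≢ : ∀ {u v} → Arc D u v → u ≢ v
  arc⇒≢ u→v refl = arc⇒part≢ u→v refl

  arc-asym : ∀ {u v} → Arc D u v → ¬ Arc D v u
  arc-asym {u} {v} u→v v→u with oriented u v (arc⇒part≢ u→v)
  ... | inj₁ (_ , v↛u) = v↛u v→u
  ... | inj₂ (_ , u↛v) = u↛v u→v

  arc-total : ∀ {u v} → part u ≢ part v → Arc D u v ⊎ Arc D v u
  arc-total {u} {v} = Sum.map proj₁ proj₁ ∘ oriented u v

  commonOut⇒Adj12′ : ∀ {s t y} → s ≢ t → Arc D s y → Arc D t y → Adj12 D s t
  commonOut⇒Adj12′ s≢t s→y t→y = commonOut⇒Adj12 s≢t (arc⇒≢ s→y ∘ sym) (arc⇒≢ t→y ∘ sym) s→y t→y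

  ¬Adj12⇒beats-one : ∀ {s t p} → s ≢ t → ¬ Adj12 D s t → part p ≢ part s → part p ≢ part t →
    Arc D p s ⊎ Arc D p t
  ¬Adj12⇒beats-one s≢t s≁t p≁s p≁t with arc-total p≁s | arc-total p≁t
  ... | inj₁ p→s | _        = inj₁ p→s
  ... | _        | inj₁ p→t = inj₂ p→t
  ... | inj₂ s→p | inj₂ t→p = contradiction (commonOut⇒Adj12′ s≢t s→p t→p) s≁t

  module _ {X : Fin k} where

    ∉∈⇒part≢ : ∀ {p s} → part p ≢ X → part s ≡ X → part p ≢ part s
    ∉∈⇒part≢ p∉X s∈X p~s = p∉X (trans p~s s∈X)

    ∉∈⇒≢ : ∀ {p s} → part p ≢ X → part s ≡ X → p ≢ s
    ∉∈⇒≢ p∉X s∈X = ∉∈⇒part≢ p∉X s∈X ∘ cong part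

    ∈-arc⇒∉ : ∀ {x p} → part x ≡ X → Arc D x p → part p ≢ X
    ∈-arc⇒∉ x∈X x→p p∈X = arc⇒part≢ x→p (trans x∈X (sym p∈X))

  PairAbsorbing : Fin k → Set
  PairAbsorbing X = ∀ {p q} → part p ≢ X → part q ≢ X → ∃ λ t → part t ≡ X × Arc D p t × Arc D q t

  antiCompeting⊆X⇒pairAbsorbing : ∀ {X} {T : Subset n} → 3 ≤ ∣ T ∣ → AntiCompeting D T →
    (∀ v → v ∈ T → part v ≡ X) → PairAbsorbing X
  antiCompeting⊆X⇒pairAbsorbing {X} {T} ∣T∣≥3 antiT T⊆X p∉X q∉X
    with a , b , c , a∈T , b∈T , c∈T , a≢b , a≢c , b≢c ← three-distinct ∣T∣≥3
    = hitsEveryPair⇒commonTarget (Arc D) a b c (T⊆X a a∈T) (T⊆X b b∈T) (T⊆X c c∈T)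
        (hits p∉X) (hits q∉X)
    where
    beats-one : ∀ {s t r} → s ∈ T → t ∈ T → s ≢ t → part r ≢ X → Arc D r s ⊎ Arc D r t
    beats-one s∈T t∈T s≢t r∉X = ¬Adj12⇒beats-one s≢t (antiT _ _ s∈T t∈T)
      (∉∈⇒part≢ r∉X (T⊆X _ s∈T)) (∉∈⇒part≢ r∉X (T⊆X _ t∈T))

    hits : ∀ {r} → part r ≢ X → HitsEveryPair (Arc D) a b c r
    hits r∉X = beats-one a∈T b∈T a≢b r∉X , beats-one a∈T c∈T a≢c r∉X , beats-one b∈T c∈T b≢c r∉X

  module _ {X : Fin k} (absorbing : PairAbsorbing X) where

    outside⇒Adj12 : ∀ {p q} → p ≢ q → part p ≢ X → part q ≢ X → Adj12 D p q
    outside⇒Adj12 p≢q p∉X q∉X with _ , _ , p→t , q→t ← absorbing p∉X q∉X =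
      commonOut⇒Adj12′ p≢q p→t q→t

    inside-outside⇒Adj12 : ∀ {x p v} → part x ≡ X → part v ≢ X → Arc D x p → p ≢ v → Adj12 D x v
    inside-outside⇒Adj12 {x} x∈X v∉X x→p p≢v
      with t , t∈X , p→t , v→t ← absorbing (∈-arc⇒∉ x∈X x→p) v∉X =
      path₂-arc⇒Adj12 (∉∈⇒≢ v∉X x∈X ∘ sym) p≢v t≢x (∉∈⇒≢ v∉X t∈X ∘ sym) x→p p→t v→t
      where
      t≢x : t ≢ x
      t≢x refl = arc-asym x→p p→t

    arc-or-Adj12 : NoSinks D → ∀ {x v} → part x ≡ X → part v ≢ X → Arc D x v ⊎ Adj12 D x v
    arc-or-Adj12 noSinks {x} {v} x∈X v∉X with p , x→p ← noSinks x with p ≟ v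
    ... | yes refl = inj₁ x→p
    ... | no p≢v   = inj₂ (inside-outside⇒Adj12 x∈X v∉X x→p p≢v)

    antiCompeting-others∈X : ∀ {S u v} → AntiCompeting D S → v ∈ S → part v ≢ X → u ∈ S → u ≢ v →
      part u ≡ X
    antiCompeting-others∈X anti v∈S v∉X u∈S u≢v = decidable-stable (part _ ≟ X) λ u∉X →
      anti _ _ u∈S v∈S (outside⇒Adj12 u≢v u∉X v∉X)

    pairAbsorbing⇒antiCompeting⊆X : NoSinks D → ∀ {S} → AntiCompeting D S → 3 ≤ ∣ S ∣ →
      ∀ {v} → v ∈ S → part v ≡ X
    pairAbsorbing⇒antiCompeting⊆X noSinks anti ∣S∣≥3 {v} v∈S = decidable-stable (part v ≟ X) ¬outside
      where
      ¬outside : ¬ part v ≢ X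
      ¬outside v∉X with x , y , x∈S , y∈S , x≢v , y≢v , x≢y ← two-others ∣S∣≥3 v
        with arc-or-Adj12 noSinks (antiCompeting-others∈X anti v∈S v∉X x∈S x≢v) v∉X
           | arc-or-Adj12 noSinks (antiCompeting-others∈X anti v∈S v∉X y∈S y≢v) v∉X
      ... | inj₂ x~v | _        = anti _ _ x∈S v∈S x~v
      ... | _        | inj₂ y~v = anti _ _ y∈S v∈S y~v
      ... | inj₁ x→v | inj₁ y→v = anti _ _ x∈S y∈S (commonOut⇒Adj12′ x≢y x→v y→v)

lemma3p7 : ∀ {n k : ℕ} (D : Digraph n) (part : Fin n → Fin k) →
    IsMultipartiteTournament D k part → NoSinks D →
    (X : Fin k) →
    (∃ λ (T : Subset n) → ∣ T ∣ ≡ 3 × AntiCompeting D T × (∀ v → v ∈ T → part v ≡ X)) →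
    ∀ (S : Subset n) → AntiCompeting D S → ∣ S ∣ ≥ 3 → ∀ v → v ∈ S → part v ≡ X
lemma3p7 D part mt noSinks X (T , ∣T∣≡3 , antiT , T⊆X) S antiS ∣S∣≥3 v v∈S =
  pairAbsorbing⇒antiCompeting⊆X absorbing noSinks antiS ∣S∣≥3 v∈S
  where
  open MultipartiteTournamentProperties mt
  absorbing : PairAbsorbing X
  absorbing = antiCompeting⊆X⇒pairAbsorbing (≤-reflexive (sym ∣T∣≡3)) antiT T⊆X
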